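{- Let $k\ge 2$. If $X\subseteq V(G_k)$ is small, then there exist $i,j$ such that $R_i\cap X=C_j\cap X=\emptyset$.
   Context: $G_k$ is the $k\times k$-grid with vertex set $\{(i,j):1\le i,j\le k\}$ and edges $(i,j)(i',j')$ with $|i-i'|+|j-j'|=1$. $C_i=\{(i,j):1\le j\le k\}$ and $R_j=\{(i,j):1\le i\le k\}$. For $X\subseteq V(G_k)$, $\operatorname{mm}(X)$ is the size of a maximum matching in $G_k$ among the edges with one end in $X$ and the other in $V(G_k)\setminus X$. A set $X\subseteq V(G_k)$ is small if $\operatorname{mm}(X)<k$ and $R_i\not\subseteq X$ for all $i=1,\dots,k$. -}

module Defs where

open import Data.Nat using (ℕ; _+_; _<_; ∣_-_∣)
open import Data.Fin using (Fin; toℕ)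
open import Data.Bool using (Bool; true; false)
open import Data.Product using (_×_; _,_; proj₁; proj₂; ∃-syntax)
open import Data.List using (List; []; _∷_; length; concatMap)
open import Data.List.Relation.Unary.All using (All)
open import Data.List.Relation.Unary.Unique.Propositional using (Unique)
open import Relation.Binary.PropositionalEquality using (_≡_)

-- Vertices of the k×k grid G_k, 0-indexed: (i , j) stands for (i+1, j+1).
Vertex : ℕ → Set
Vertex k = Fin k × Fin k

VSet : ℕ → Set
VSet k = Vertex k → Bool

Adjacent : ∀ {k} → Vertex k → Vertex k → Set
Adjacent (i , j) (i' , j') = ∣ toℕ i - toℕ i' ∣ + ∣ toℕ j - toℕ j' ∣ ≡ 1

BoundaryEdge : ∀ {k} → VSet k → Vertex k × Vertex k → Set
BoundaryEdge X (u , v) = (X u ≡ true) × (X v ≡ false) × Adjacent u v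

endpoints : ∀ {k} → List (Vertex k × Vertex k) → List (Vertex k)
endpoints = concatMap (λ e → proj₁ e ∷ proj₂ e ∷ [])

IsBoundaryMatching : ∀ {k} → VSet k → List (Vertex k × Vertex k) → Set
IsBoundaryMatching X M = All (BoundaryEdge X) M × Unique (endpoints M)

-- mm(X) < m : every such matching has fewer than m edges.
MMLessThan : ∀ {k} → VSet k → ℕ → Set
MMLessThan X m = ∀ M → IsBoundaryMatching X M → length M < m

-- R_j = {(i,j) : i}  (second coordinate fixed);  C_i = {(i,j) : j}.
RowNotSubset : ∀ {k} → VSet k → Fin k → Set
RowNotSubset X j = ∃[ i ] X (i , j) ≡ false

Small : ∀ k → VSet k → Set
Small k X = MMLessThan X k × (∀ j → RowNotSubset X j)

RowDisjoint : ∀ {k} → VSet k → Fin k → Set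
RowDisjoint X j = ∀ i → X (i , j) ≡ false

ColDisjoint : ∀ {k} → VSet k → Fin k → Set
ColDisjoint X i = ∀ j → X (i , j) ≡ false

-- If no row avoided X, every row would contain a vertex of X and (X being small) a vertex
-- outside X, hence an edge of the row between X and its complement; these k edges lie in
-- distinct rows and form a matching of size k, contradicting mm(X) < k. So some row R
-- avoids X. Now every column meets R outside X, and the same argument applied to the
-- columns yields a column avoiding X.
module Submission where

open import Defs
open import Data.Bool using (Bool; true; false; _≟_)
open import Data.Bool.Properties using (¬-not)
open import Data.Empty using (⊥-elim)
open import Data.Fin using (Fin; toℕ; inject₁) renaming (zero to fzero; suc to fsuc)
open import Data.Fin.Properties using (toℕ-inject₁; any?; all?; ¬∀⟶∃¬)
open import Data.List using ([]; _∷_; map; allFin)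
open import Data.List.Properties using (length-map; length-tabulate)
open import Data.List.Relation.Unary.All as All using (All; []; _∷_)
import Data.List.Relation.Unary.AllPairs as AllPairs
open import Data.List.Relation.Unary.Unique.Propositional using (Unique)
open import Data.List.Relation.Unary.Unique.Propositional.Properties using (allFin⁺)
open import Data.Nat using (ℕ; suc; _≤_; _+_; ∣_-_∣)
open import Data.Nat.Properties using (∣n-n∣≡0; ∣-∣-comm; +-identityʳ; <-irrefl)
open import Data.Product using (_×_; _,_; proj₁; proj₂; ∃-syntax; ∃₂)
open import Function using (_∘_)
open import Relation.Nullary using (¬_; yes; no; contradiction)
open import Relation.Binary.PropositionalEquality
  using (_≡_; _≢_; refl; sym; trans; cong)

∣n-1+n∣≡1 : ∀ n → ∣ n - suc n ∣ ≡ 1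
∣n-1+n∣≡1 0       = refl
∣n-1+n∣≡1 (suc n) = ∣n-1+n∣≡1 n

∣inject₁-suc∣≡1 : ∀ {n} (i : Fin n) → ∣ toℕ (inject₁ i) - toℕ (fsuc i) ∣ ≡ 1
∣inject₁-suc∣≡1 i rewrite toℕ-inject₁ i = ∣n-1+n∣≡1 (toℕ i)

∃-change-from-zero : ∀ {n} (f : Fin (suc n) → Bool) q → f fzero ≢ f q →
                     ∃[ i ] f (inject₁ i) ≢ f (fsuc i)
∃-change-from-zero         f fzero    f₀≢fq = ⊥-elim (f₀≢fq refl)
∃-change-from-zero {suc n} f (fsuc q) f₀≢fq with f fzero ≟ f (fsuc fzero)
... | no f₀≢f₁  = fzero , f₀≢f₁
... | yes f₀≡f₁ = let i , fi≢fsi = ∃-change-from-zero (f ∘ fsuc) q (f₀≢fq ∘ trans f₀≡f₁)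
                  in fsuc i , fi≢fsi

Crossing : ∀ {n} → (Fin n → Bool) → Set
Crossing f = ∃₂ λ a b → f a ≡ true × f b ≡ false × ∣ toℕ a - toℕ b ∣ ≡ 1

change⇒crossing : ∀ {n} (f : Fin (suc n) → Bool) →
                   (∃[ i ] f (inject₁ i) ≢ f (fsuc i)) → Crossing f
change⇒crossing f (i , fi≢fsi) with f (inject₁ i) in fi
... | true  = inject₁ i , fsuc i , fi , ¬-not (fi≢fsi ∘ sym) , ∣inject₁-suc∣≡1 i
... | false = fsuc i , inject₁ i , ¬-not (fi≢fsi ∘ sym) , fi ,
              trans (∣-∣-comm (toℕ (fsuc i)) (toℕ (inject₁ i))) (∣inject₁-suc∣≡1 i)

∃-crossing : ∀ {n} (f : Fin n → Bool) {p q} → f p ≡ true → f q ≡ false → Crossing f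
∃-crossing {suc n} f {p} {q} fp fq with f fzero ≟ f q
... | no f₀≢fq  = change⇒crossing f (∃-change-from-zero f q f₀≢fq)
... | yes f₀≡fq = change⇒crossing f (∃-change-from-zero f p λ f₀≡fp →
  contradiction (trans (sym fp) (trans (sym f₀≡fp) (trans f₀≡fq fq))) λ ())

module _ {k} {I : Set} (X : VSet k) (index : Vertex k → I)
         (edge : I → Vertex k × Vertex k)
         (edge-boundary : ∀ j → BoundaryEdge X (edge j))
         (edge-within : ∀ j → index (proj₁ (edge j)) ≡ j × index (proj₂ (edge j)) ≡ j)
         where

  all-boundary : ∀ js → All (BoundaryEdge X) (map edge js)
  all-boundary []       = []
  all-boundary (j ∷ js) = edge-boundary j ∷ all-boundary js

  endpoints-avoid : ∀ {j} js → All (j ≢_) js → All (λ w → index w ≢ j) (endpoints (map edge js))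
  endpoints-avoid []        []           = []
  endpoints-avoid (j′ ∷ js) (j≢j′ ∷ ps) =
    (λ eq → j≢j′ (trans (sym eq) (proj₁ (edge-within j′)))) ∷
    (λ eq → j≢j′ (trans (sym eq) (proj₂ (edge-within j′)))) ∷ endpoints-avoid js ps

  unique-endpoints : ∀ js → Unique js → Unique (endpoints (map edge js))
  unique-endpoints []       _ = AllPairs.[]
  unique-endpoints (j ∷ js) (j∉js AllPairs.∷ js-unique) =
    (u≢v ∷ All.map (apart (proj₁ (edge-within j))) avoid) AllPairs.∷
    (All.map (apart (proj₂ (edge-within j))) avoid AllPairs.∷ unique-endpoints js js-unique)
    where
    avoid : All (λ w → index w ≢ j) (endpoints (map edge js))
    avoid = endpoints-avoid js j∉js
    apart : ∀ {w w′} → index w ≡ j → index w′ ≢ j → w ≢ w′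
    apart iw≡j iw′≢j w≡w′ = iw′≢j (trans (cong index (sym w≡w′)) iw≡j)
    u≢v : proj₁ (edge j) ≢ proj₂ (edge j)
    u≢v u≡v with edge-boundary j
    ... | Xu , Xv , _ = contradiction (trans (sym Xu) (trans (cong X u≡v) Xv)) λ ()

  map-isBoundaryMatching : ∀ {js} → Unique js → IsBoundaryMatching X (map edge js)
  map-isBoundaryMatching {js} js-unique = all-boundary js , unique-endpoints js js-unique

record Lines (k : ℕ) : Set where
  field
    point          : Fin k → Fin k → Vertex k
    index          : Vertex k → Fin k
    index-point    : ∀ j a → index (point j a) ≡ j
    point-adjacent : ∀ j {a b} → ∣ toℕ a - toℕ b ∣ ≡ 1 → Adjacent (point j a) (point j b)

rows : ∀ k → Lines k
rows k = record
  { point          = λ j i → i , j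
  ; index          = proj₂
  ; index-point    = λ _ _ → refl
  ; point-adjacent = λ j {a} {b} d → trans (cong (∣ toℕ a - toℕ b ∣ +_) (∣n-n∣≡0 (toℕ j)))
                                           (trans (+-identityʳ _) d)
  }

columns : ∀ k → Lines k
columns k = record
  { point          = λ i j → i , j
  ; index          = proj₁
  ; index-point    = λ _ _ → refl
  ; point-adjacent = λ i d → trans (cong (_+ _) (∣n-n∣≡0 (toℕ i))) d
  }

module _ {k} (L : Lines k) (X : VSet k) where
  open Lines L

  lines-crossing⇒¬MMLessThan : (∀ j → ∃[ a ] X (point j a) ≡ true) →
                               (∀ j → ∃[ a ] X (point j a) ≡ false) → ¬ MMLessThan X k
  lines-crossing⇒¬MMLessThan meets leaves mm =
    <-irrefl (trans (length-map edge (allFin k)) (length-tabulate {n = k} λ j → j))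
             (mm (map edge (allFin k))
                 (map-isBoundaryMatching X index edge boundary within (allFin⁺ k)))
    where
    crossing : ∀ j → Crossing (X ∘ point j)
    crossing j = ∃-crossing (X ∘ point j) (proj₂ (meets j)) (proj₂ (leaves j))
    edge : Fin k → Vertex k × Vertex k
    edge j = let a , b , _ = crossing j in point j a , point j b
    boundary : ∀ j → BoundaryEdge X (edge j)
    boundary j = let _ , _ , Xa , Xb , d = crossing j in Xa , Xb , point-adjacent j d
    within : ∀ j → index (proj₁ (edge j)) ≡ j × index (proj₂ (edge j)) ≡ j
    within j = index-point j _ , index-point j _

  ∃-line-disjoint : MMLessThan X k → (∀ j → ∃[ a ] X (point j a) ≡ false) →
                    ∃[ j ] ∀ a → X (point j a) ≡ false
  ∃-line-disjoint mm leaves with any? (λ j → all? (λ a → X (point j a) ≟ false))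
  ... | yes disjoint = disjoint
  ... | no ¬disjoint = ⊥-elim (lines-crossing⇒¬MMLessThan meets leaves mm)
    where
    meets : ∀ j → ∃[ a ] X (point j a) ≡ true
    meets j = let a , Xa≢false = ¬∀⟶∃¬ k _ (λ a → X (point j a) ≟ false) (¬disjoint ∘ (j ,_))
              in a , ¬-not Xa≢false

lemma4p4 : (k : ℕ) → 2 ≤ k → (X : VSet k) → Small k X →
    ∃[ i ] ∃[ j ] (RowDisjoint X i × ColDisjoint X j)
lemma4p4 k _ X (mm , rows-not-in-X) =
  let i , Rᵢ∩X≡∅ = ∃-line-disjoint (rows k) X mm rows-not-in-X
      j , Cⱼ∩X≡∅ = ∃-line-disjoint (columns k) X mm (λ j → i , Rᵢ∩X≡∅ j)
  in i , j , Rᵢ∩X≡∅ , Cⱼ∩X≡∅
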